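{- Let $\mu$ be a partition and let $\lambda$ and $\nu$ be finite sequences of integers. Then the sequence with general term $$b_{\lambda+(n),\,\mu}^{\nu+(|\mu|\cdot n)} = \big\langle h_{\lambda+(n)}[s_\mu],\ h_{\nu+(|\mu|\cdot n)}\big\rangle,\qquad n\ge 0,$$ is eventually constant. Moreover, if $\ell(\mu)>1$, its eventual value is zero.
   Context: For a finite sequence of integers $\alpha=(\alpha_1,\dots,\alpha_k)$, $h_\alpha=h_{\alpha_1}\cdots h_{\alpha_k}$ where $h_r$ is the complete homogeneous symmetric function ($h_0=1$, $h_r=0$ for $r<0$). For a partition $\mu$ and finite sequences of integers $\lambda,\nu$, $b_{\lambda,\mu}^{\nu}=\langle h_\lambda[s_\mu],h_\nu\rangle$, where $s_\mu$ is the Schur function, $f[g]$ is plethysm and $\langle\cdot,\cdot\rangle$ is the Hall inner product. For a sequence $\alpha$ and an integer $k$, $\alpha+(k)$ denotes $\alpha$ with $k$ added to its first entry. $|\mu|$ is the sum of the parts of $\mu$ and $\ell(\mu)$ its number of nonzero parts. -}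

module Defs where

open import Data.Bool using (Bool; true; false; _∧_)
open import Data.Nat using (ℕ; zero; suc; _+_; _<_; _≥_; _≤ᵇ_; _<ᵇ_)
import Data.Nat as ℕ
open import Data.Integer as ℤ using (ℤ; +_; -[1+_])
open import Data.Fin using (toℕ)
open import Data.List using (List; []; _∷_; _++_; map; concatMap; filter; length; foldr; zipWith; upTo; concat)
open import Data.Nat.ListAction using (sum)
open import Data.Bool.ListAction using (and)
open import Data.List.Properties using (≡-dec)
open import Data.List.Relation.Unary.All using (All)
open import Data.List.Relation.Unary.Linked using (Linked)
open import Data.Vec as Vec using (Vec)

-- α + (k): add k to the first entry of α.  Convention for the empty
-- sequence: it is read as (0) (padding with zeros, harmless since h_0 = 1).
_⊕₁_ : List ℤ → ℤ → List ℤ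
[] ⊕₁ k = k ∷ []
(a ∷ as) ⊕₁ k = (a ℤ.+ k) ∷ as

IsPartition : List ℕ → Set
IsPartition μ = All (0 <_) μ × Linked _≥_ μ
  where open import Data.Product using (_×_)

∣_∣ₚ : List ℕ → ℕ
∣ μ ∣ₚ = sum μ

ℓ : List ℕ → ℕ
ℓ μ = length μ

-- Polynomials in N variables x_0,…,x_{N-1} with nonnegative integer
-- coefficients, represented as formal sums (lists) of monomials; a
-- monomial is its exponent vector.  The coefficient of a monomial is
-- its multiplicity in the list.

Monomial : ℕ → Set
Monomial N = Vec ℕ N

Poly : ℕ → Set
Poly N = List (Monomial N)

one : ∀ {N} → Poly N
one = Vec.replicate _ 0 ∷ []

_*ₘ_ : ∀ {N} → Monomial N → Monomial N → Monomial N
_*ₘ_ = Vec.zipWith _+_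

_*ₚ_ : ∀ {N} → Poly N → Poly N → Poly N
p *ₚ q = concatMap (λ a → map (a *ₘ_) q) p

prodₘ : ∀ {N} → List (Monomial N) → Monomial N
prodₘ = foldr _*ₘ_ (Vec.replicate _ 0)

-- coefficient of x^ν (ν a sequence of integers of length N; 0 if some
-- entry is negative or the length is wrong)
coeff : ∀ {N} → Poly N → List ℤ → ℕ
coeff p ν = length (filter (λ m → ≡-dec ℤ._≟_ (map +_ (Vec.toList m)) ν) p)

listsOf : ℕ → ℕ → List (List ℕ)
listsOf zero N = [] ∷ []
listsOf (suc l) N = concatMap (λ x → map (x ∷_) (listsOf l N)) (upTo N)

choices : {A : Set} → List (List A) → List (List A)
choices [] = [] ∷ []
choices (xs ∷ xss) = concatMap (λ x → map (x ∷_) (choices xss)) xs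

fillings : List ℕ → ℕ → List (List (List ℕ))
fillings μ N = choices (map (λ l → listsOf l N) μ)

rowWeak : List ℕ → Bool
rowWeak [] = true
rowWeak (x ∷ []) = true
rowWeak (x ∷ y ∷ r) = (x ≤ᵇ y) ∧ rowWeak (y ∷ r)

colsStrict : List (List ℕ) → Bool
colsStrict [] = true
colsStrict (r ∷ []) = true
colsStrict (r ∷ r' ∷ rs) = and (zipWith _<ᵇ_ r r') ∧ colsStrict (r' ∷ rs)

isSSYT : List (List ℕ) → Bool
isSSYT T = and (map rowWeak T) ∧ colsStrict T

content : (N : ℕ) → List (List ℕ) → Monomial N
content N T = Vec.tabulate (λ i → length (filter (λ x → x ℕ.≟ toℕ i) (concat T)))

schur : List ℕ → (N : ℕ) → Poly N
schur μ N = map (content N) (filter (λ T → isSSYT T Data.Bool.≟ true) (fillings μ N))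
  where import Data.Bool

-- Plethysm h_r[g] for g a sum of monomials y_1 + … + y_M (coefficients
-- 1, counted with multiplicity):  h_r[g] = h_r(y_1,…,y_M)
--   = Σ over multisets {i_1 ≤ … ≤ i_r} of y_{i_1} ⋯ y_{i_r}.

multisets : {A : Set} → ℕ → List A → List (List A)
multisets zero xs = [] ∷ []
multisets (suc r) [] = []
multisets (suc r) (x ∷ xs) = map (x ∷_) (multisets r (x ∷ xs)) ++ multisets (suc r) xs

hPleth : ∀ {N} → ℤ → Poly N → Poly N
hPleth (+ r) g = map prodₘ (multisets r g)
hPleth -[1+ r ] g = []

hλPleth : ∀ {N} → List ℤ → Poly N → Poly N
hλPleth λs g = foldr (λ r acc → hPleth r g *ₚ acc) one λs

-- b^ν_{λ,μ} = ⟨h_λ[s_μ], h_ν⟩ = coefficient of m_ν (equivalently, by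
-- symmetry, of the monomial x^ν) in h_λ[s_μ]; computed in ℓ = length ν
-- variables, which suffices since x^ν involves only those variables.
-- (0 automatically if ν has a negative entry, i.e. h_ν = 0.)

b : List ℤ → List ℕ → List ℤ → ℕ
b λs μ ν = coeff (hλPleth λs (schur μ (length ν))) ν

{-# OPTIONS --safe #-}
-- Single out the variable x₀, whose exponent in x^ν is ν₁, and grade monomials
-- by their tail degree, the total degree in the remaining variables; x^ν has
-- tail degree Σ_{i>1} ν_i.  If ℓ(μ) > 1, column strictness forces a nonzero
-- entry below the corner of every SSYT, so every monomial of s_μ has tail
-- degree ≥ 1 and every monomial of h_r[s_μ] tail degree ≥ r: the coefficient
-- vanishes once r is large.  If ℓ(μ) ≤ 1, then s_μ = x₀^|μ| + X with X of tail
-- degree ≥ 1, and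
--   h_{r+1}[x₀^|μ| + X] = x₀^|μ| · h_r[x₀^|μ| + X] + h_{r+1}[X],
-- where for large r the last summand cannot contribute to x^ν; so raising r by
-- one and ν₁ by |μ| leaves the coefficient unchanged.

module Submission where

open import Defs
open import Data.Nat using (ℕ; zero; suc; _+_; _*_; _∸_; _≤_; _<_; z≤n; s≤s; _<?_; _<ᵇ_)
import Data.Nat.Properties as ℕ
open import Data.Nat.ListAction using (sum)
open import Data.Integer using (ℤ; +_; -[1+_]; ∣_∣)
import Data.Integer as ℤ
import Data.Integer.Properties as ℤ
open import Algebra.Properties.AbelianGroup ℤ.+-0-abelianGroup using (∙-cancelʳ)
open import Data.List using (List; []; _∷_; _++_; map; filter; length; concat; concatMap; replicate; applyUpTo; upTo; zipWith)
import Data.List.Properties as List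
open import Data.List.Relation.Unary.All as All using (All; []; _∷_)
import Data.List.Relation.Unary.All.Properties as All
open import Data.List.Relation.Unary.Any as Any using (Any; here; there)
import Data.List.Relation.Unary.Any.Properties as Any
open import Data.List.Membership.Propositional using (find)
open import Data.Vec as Vec using (Vec; toList)
import Data.Vec.Properties as Vec
open import Data.Fin using (Fin; toℕ; fromℕ<)
import Data.Fin.Properties as Fin
import Data.Bool as Bool
open import Data.Bool using (true)
open import Data.Bool.Properties using (T-≡; ∧-conicalˡ; ∧-conicalʳ)
open import Data.Bool.ListAction using (and)
open import Data.Product using (Σ; _×_; _,_; proj₁; proj₂)
open import Function using (_∘_; _⇔_; mk⇔; Equivalence)
open import Relation.Nullary using (yes; no)
open import Data.Empty using (⊥-elim)
open import Relation.Unary using (Decidable)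
open import Relation.Binary.PropositionalEquality using (_≡_; _≢_; refl; sym; trans; cong; cong₂; subst; module ≡-Reasoning)
open import Algebra.Properties.CommutativeSemigroup ℕ.+-commutativeSemigroup using (interchange)

Eventually : (ℕ → Set) → Set
Eventually P = Σ ℕ λ n₀ → (n : ℕ) → n₀ ≤ n → P n

eventually-+ : {P : ℕ → Set} (k : ℕ) → Eventually (λ t → P (k + t)) → Eventually P
eventually-+ {P} k (n₀ , ev) = n₀ + k , λ n n₀+k≤n →
  subst P (ℕ.m+[n∸m]≡n (ℕ.m+n≤o⇒n≤o n₀ n₀+k≤n)) (ev (n ∸ k) (ℕ.m+n≤o⇒m≤o∸n n₀ n₀+k≤n))

eventually-stable⇒const : (f : ℕ → ℕ) → Eventually (λ t → f (suc t) ≡ f t) →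
                          Σ ℕ λ c → Eventually (λ t → f t ≡ c)
eventually-stable⇒const f (n₀ , stable) = f n₀ , n₀ , λ n n₀≤n →
  subst (λ m → f m ≡ f n₀) (ℕ.m+[n∸m]≡n n₀≤n) (go (n ∸ n₀))
  where
  go : ∀ d → f (n₀ + d) ≡ f n₀
  go zero    = cong f (ℕ.+-identityʳ n₀)
  go (suc d) = trans (cong f (ℕ.+-suc n₀ d)) (trans (stable (n₀ + d) (ℕ.m≤m+n n₀ d)) (go d))

ℤ-shift-nonneg : ∀ a → Σ ℕ λ n₁ → Σ ℕ λ a₀ → ∀ t → a ℤ.+ + (n₁ + t) ≡ + (a₀ + t)
ℤ-shift-nonneg (+ a₀)    = 0 , a₀ , λ t → refl
ℤ-shift-nonneg -[1+ j ] = suc j , 0 , λ t →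
  trans (ℤ.⊖-≥ (ℕ.m≤m+n (suc j) t)) (cong +_ (ℕ.m+n∸m≡n (suc j) t))

length-filter-map : {A B : Set} {P : B → Set} {Q : A → Set} (P? : Decidable P) (Q? : Decidable Q)
                    (f : A → B) → (∀ x → P (f x) ⇔ Q x) →
                    ∀ xs → length (filter P? (map f xs)) ≡ length (filter Q? xs)
length-filter-map P? Q? f P∘f⇔Q []       = refl
length-filter-map P? Q? f P∘f⇔Q (x ∷ xs) with Q? x
... | yes qx = trans (cong length (List.filter-accept P? {xs = map f xs} (Equivalence.from (P∘f⇔Q x) qx)))
                     (cong suc (length-filter-map P? Q? f P∘f⇔Q xs))
... | no ¬qx = trans (cong length (List.filter-reject P? {xs = map f xs} (¬qx ∘ Equivalence.to (P∘f⇔Q x))))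
                     (length-filter-map P? Q? f P∘f⇔Q xs)

lookup≤sum : ∀ {n} (v : Vec ℕ n) i → Vec.lookup v i ≤ Vec.sum v
lookup≤sum (x Vec.∷ v) Fin.zero    = ℕ.m≤m+n x (Vec.sum v)
lookup≤sum (x Vec.∷ v) (Fin.suc i) = ℕ.≤-trans (lookup≤sum v i) (ℕ.m≤n+m (Vec.sum v) x)

sum-zipWith-+ : ∀ {n} (u v : Vec ℕ n) → Vec.sum (Vec.zipWith _+_ u v) ≡ Vec.sum u + Vec.sum v
sum-zipWith-+ Vec.[]       Vec.[]       = refl
sum-zipWith-+ (x Vec.∷ u) (y Vec.∷ v) =
  trans (cong (λ s → x + y + s) (sum-zipWith-+ u v)) (interchange x y (Vec.sum u) (Vec.sum v))

tabulate-zeros : ∀ {n} (f : Fin n → ℕ) → (∀ i → f i ≡ 0) → Vec.tabulate f ≡ Vec.replicate n 0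
tabulate-zeros {zero}  f f≡0 = refl
tabulate-zeros {suc n} f f≡0 = cong₂ Vec._∷_ (f≡0 Fin.zero) (tabulate-zeros (f ∘ Fin.suc) (f≡0 ∘ Fin.suc))

x₀^ : ∀ {n} → ℕ → Monomial (suc n)
x₀^ d = d Vec.∷ Vec.replicate _ 0

tailDegree : ∀ {n} → Monomial (suc n) → ℕ
tailDegree u = Vec.sum (Vec.tail u)

TailDegree≥ : ∀ {n} → ℕ → Poly (suc n) → Set
TailDegree≥ k p = All (λ u → k ≤ tailDegree u) p

absSum : List ℤ → ℕ
absSum zs = sum (map ∣_∣ zs)

tailDegree-*ₘ : ∀ {n} (u v : Monomial (suc n)) → tailDegree (u *ₘ v) ≡ tailDegree u + tailDegree v
tailDegree-*ₘ (_ Vec.∷ u) (_ Vec.∷ v) = sum-zipWith-+ u v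

sum≡absSum-toList : ∀ {n} (v : Vec ℕ n) → Vec.sum v ≡ absSum (map +_ (toList v))
sum≡absSum-toList Vec.[]       = refl
sum≡absSum-toList (x Vec.∷ v) = cong (λ s → x + s) (sum≡absSum-toList v)

tailDegree-exponent : ∀ {n} (u : Monomial (suc n)) {z zs} →
                      map +_ (toList u) ≡ z ∷ zs → tailDegree u ≡ absSum zs
tailDegree-exponent (_ Vec.∷ u) refl = sum≡absSum-toList u

*ₘ-assoc : ∀ {n} (x y v : Monomial n) → (x *ₘ y) *ₘ v ≡ x *ₘ (y *ₘ v)
*ₘ-assoc = Vec.zipWith-assoc ℕ.+-assoc

*ₚ-distribʳ-++ : ∀ {n} (A B P : Poly n) → (A ++ B) *ₚ P ≡ A *ₚ P ++ B *ₚ P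
*ₚ-distribʳ-++ A B P = List.concatMap-++ _ A B

map-*ₘ-*ₚ : ∀ {n} (x : Monomial n) (A P : Poly n) → map (x *ₘ_) A *ₚ P ≡ map (x *ₘ_) (A *ₚ P)
map-*ₘ-*ₚ x A P = begin
  concatMap (λ a → map (a *ₘ_) P) (map (x *ₘ_) A)   ≡⟨ List.concatMap-map _ _ A ⟩
  concatMap (λ a → map ((x *ₘ a) *ₘ_) P) A           ≡⟨ List.concatMap-cong x*a*P A ⟩
  concatMap (λ a → map (x *ₘ_) (map (a *ₘ_) P)) A   ≡⟨ List.map-concatMap _ _ A ⟨
  map (x *ₘ_) (A *ₚ P)                               ∎
  where
  open ≡-Reasoning
  x*a*P : ∀ a → map ((x *ₘ a) *ₘ_) P ≡ map (x *ₘ_) (map (a *ₘ_) P)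
  x*a*P a = trans (List.map-cong (*ₘ-assoc x a) P) (List.map-∘ P)

coeff-++ : ∀ {n} (p q : Poly n) ν → coeff (p ++ q) ν ≡ coeff p ν + coeff q ν
coeff-++ p q ν = trans (cong length (List.filter-++ _ p q)) (List.length-++ (filter _ p))

coeff-vanish : ∀ {n} (p : Poly (suc n)) z zs → TailDegree≥ (suc (absSum zs)) p → coeff p (z ∷ zs) ≡ 0
coeff-vanish p z zs p>zs = cong length (List.filter-none _
  (All.map (λ {u} zs<u eq → ℕ.<-irrefl (sym (tailDegree-exponent u eq)) zs<u) p>zs))

x₀^-*ₘ : ∀ {n} d v₀ (v : Vec ℕ n) → x₀^ d *ₘ (v₀ Vec.∷ v) ≡ (d + v₀) Vec.∷ v
x₀^-*ₘ d v₀ v = cong ((d + v₀) Vec.∷_) (Vec.zipWith-identityˡ ℕ.+-identityˡ v)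

exponent-x₀^-*ₘ : ∀ {n} d (v : Monomial (suc n)) w zs →
  (map +_ (toList (x₀^ d *ₘ v)) ≡ (w ℤ.+ + d) ∷ zs) ⇔ (map +_ (toList v) ≡ w ∷ zs)
exponent-x₀^-*ₘ d (v₀ Vec.∷ v) w zs = mk⇔
  (λ eq → let eq′ = trans (sym exponent-≡) eq in
          cong₂ _∷_ (Equivalence.to head⇔ (List.∷-injectiveˡ eq′)) (List.∷-injectiveʳ eq′))
  (λ eq → trans exponent-≡ (cong₂ _∷_ (Equivalence.from head⇔ (List.∷-injectiveˡ eq)) (List.∷-injectiveʳ eq)))
  where
  exponent-≡ : map +_ (toList (x₀^ d *ₘ (v₀ Vec.∷ v))) ≡ + (d + v₀) ∷ map +_ (toList v)
  exponent-≡ = cong (map +_ ∘ toList) (x₀^-*ₘ d v₀ v)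
  +d+v₀≡+v₀++d : + (d + v₀) ≡ + v₀ ℤ.+ + d
  +d+v₀≡+v₀++d = trans (cong +_ (ℕ.+-comm d v₀)) (ℤ.pos-+ v₀ d)
  head⇔ : (+ (d + v₀) ≡ w ℤ.+ + d) ⇔ (+ v₀ ≡ w)
  head⇔ = mk⇔ (λ eq → ∙-cancelʳ (+ d) (+ v₀) w (trans (sym +d+v₀≡+v₀++d) eq))
              (λ eq → trans +d+v₀≡+v₀++d (cong (ℤ._+ + d) eq))

coeff-x₀^-*ₘ : ∀ {n} d (p : Poly (suc n)) w zs →
               coeff (map (x₀^ d *ₘ_) p) ((w ℤ.+ + d) ∷ zs) ≡ coeff p (w ∷ zs)
coeff-x₀^-*ₘ d p w zs = length-filter-map _ _ (x₀^ d *ₘ_) (λ v → exponent-x₀^-*ₘ d v w zs) p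

*ₚ-TailDegree≥ : ∀ {n k} {p q : Poly (suc n)} → TailDegree≥ k p → TailDegree≥ k (p *ₚ q)
*ₚ-TailDegree≥ {k = k} {q = q} p≥k =
  All.concat⁺ (All.map⁺ (All.map (λ {a} a≥k → All.map⁺ (All.universal (a*v≥k {a} a≥k) q)) p≥k))
  where
  a*v≥k : ∀ {a} → k ≤ tailDegree a → ∀ v → k ≤ tailDegree (a *ₘ v)
  a*v≥k {a} a≥k v = ℕ.≤-trans (ℕ.≤-trans a≥k (ℕ.m≤m+n _ _)) (ℕ.≤-reflexive (sym (tailDegree-*ₘ a v)))

prodₘ-multisets-TailDegree≥ : ∀ {n} r (xs : Poly (suc n)) → TailDegree≥ 1 xs →
                             All (λ Ls → r ≤ tailDegree (prodₘ Ls)) (multisets r xs)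
prodₘ-multisets-TailDegree≥ zero    xs       _                = z≤n ∷ []
prodₘ-multisets-TailDegree≥ (suc r) []       _                = []
prodₘ-multisets-TailDegree≥ (suc r) (x ∷ xs) xs≥1@(x≥1 ∷ xs′≥1) =
  All.++⁺ (All.map⁺ (All.map (λ {Ls} → x*Ls≥1+r {Ls}) (prodₘ-multisets-TailDegree≥ r (x ∷ xs) xs≥1)))
          (prodₘ-multisets-TailDegree≥ (suc r) xs xs′≥1)
  where
  x*Ls≥1+r : ∀ {Ls} → r ≤ tailDegree (prodₘ Ls) → suc r ≤ tailDegree (prodₘ (x ∷ Ls))
  x*Ls≥1+r {Ls} Ls≥r = ℕ.≤-trans (ℕ.+-mono-≤ x≥1 Ls≥r) (ℕ.≤-reflexive (sym (tailDegree-*ₘ x (prodₘ Ls))))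

hPleth-TailDegree≥ : ∀ {n} r (g : Poly (suc n)) → TailDegree≥ 1 g → TailDegree≥ r (hPleth (+ r) g)
hPleth-TailDegree≥ r g g≥1 = All.map⁺ (prodₘ-multisets-TailDegree≥ r g g≥1)

hPleth-suc-∷ : ∀ {n} r (x : Monomial n) xs →
               hPleth (+ suc r) (x ∷ xs) ≡ map (x *ₘ_) (hPleth (+ r) (x ∷ xs)) ++ hPleth (+ suc r) xs
hPleth-suc-∷ {n} r x xs =
  trans (List.map-++ prodₘ (map (x ∷_) M) _) (cong (_++ _) (trans (sym (List.map-∘ M)) (List.map-∘ M)))
  where
  M : List (List (Monomial n))
  M = multisets r (x ∷ xs)

coeff-hPleth-*ₚ-vanish : ∀ {n} r (g P : Poly (suc n)) w zs → TailDegree≥ 1 g → absSum zs < r →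
                         coeff (hPleth (+ r) g *ₚ P) (w ∷ zs) ≡ 0
coeff-hPleth-*ₚ-vanish r g P w zs g≥1 zs<r =
  coeff-vanish _ w zs (All.map (ℕ.<-≤-trans zs<r) (*ₚ-TailDegree≥ {q = P} (hPleth-TailDegree≥ r g g≥1)))

HeadedBy : ∀ {n} → ℕ → Poly (suc n) → Set
HeadedBy d g = Σ (Poly _) λ xs → g ≡ x₀^ d ∷ xs × TailDegree≥ 1 xs

coeff-hPleth-*ₚ-stable : ∀ {n} d r (g P : Poly (suc n)) w zs → HeadedBy d g → absSum zs ≤ r →
  coeff (hPleth (+ suc r) g *ₚ P) ((w ℤ.+ + d) ∷ zs) ≡ coeff (hPleth (+ r) g *ₚ P) (w ∷ zs)
coeff-hPleth-*ₚ-stable {n} d r _ P w zs (xs , refl , xs≥1) zs≤r = begin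
  coeff (hPleth (+ suc r) (x ∷ xs) *ₚ P) ν′
    ≡⟨ cong (λ q → coeff (q *ₚ P) ν′) (hPleth-suc-∷ r x xs) ⟩
  coeff ((map (x *ₘ_) H ++ H′) *ₚ P) ν′
    ≡⟨ cong (λ q → coeff q ν′) (*ₚ-distribʳ-++ (map (x *ₘ_) H) H′ P) ⟩
  coeff (map (x *ₘ_) H *ₚ P ++ H′ *ₚ P) ν′
    ≡⟨ coeff-++ (map (x *ₘ_) H *ₚ P) (H′ *ₚ P) ν′ ⟩
  coeff (map (x *ₘ_) H *ₚ P) ν′ + coeff (H′ *ₚ P) ν′
    ≡⟨ cong₂ _+_ (cong (λ q → coeff q ν′) (map-*ₘ-*ₚ x H P))
                 (coeff-hPleth-*ₚ-vanish (suc r) xs P _ zs xs≥1 (s≤s zs≤r)) ⟩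
  coeff (map (x *ₘ_) (H *ₚ P)) ν′ + 0
    ≡⟨ ℕ.+-identityʳ _ ⟩
  coeff (map (x *ₘ_) (H *ₚ P)) ν′
    ≡⟨ coeff-x₀^-*ₘ d (H *ₚ P) w zs ⟩
  coeff (H *ₚ P) (w ∷ zs) ∎
  where
  open ≡-Reasoning
  x : Monomial (suc n)
  x = x₀^ d
  H H′ : Poly (suc n)
  H  = hPleth (+ r) (x ∷ xs)
  H′ = hPleth (+ suc r) xs
  ν′ : List ℤ
  ν′ = (w ℤ.+ + d) ∷ zs

All-filter⇒ : ∀ {A : Set} {P Q : A → Set} (P? : Decidable P) xs →
              All (λ x → P x → Q x) xs → All Q (filter P? xs)
All-filter⇒ P? xs P⇒Q = All.zipWith (λ (imp , p) → imp p) (All.filter⁺ P? P⇒Q , All.all-filter P? xs)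

All-concatMap-∷ : ∀ {A : Set} {P : List A → Set} (xs : List A) (L : List (List A)) →
                  All (λ x → All (λ ys → P (x ∷ ys)) L) xs → All P (concatMap (λ x → map (x ∷_) L) xs)
All-concatMap-∷ xs L h = All.concat⁺ (All.map⁺ (All.map All.map⁺ h))

count : ℕ → List ℕ → ℕ
count c xs = length (filter (λ x → x ℕ.≟ c) xs)

count-replicate-≡ : ∀ m c → count c (replicate m c) ≡ m
count-replicate-≡ m c = trans (cong length (List.filter-all (λ x → x ℕ.≟ c) (All.replicate⁺ m refl)))
                              (List.length-replicate m)

count-replicate-≢ : ∀ m {c d} → d ≢ c → count c (replicate m d) ≡ 0
count-replicate-≢ m d≢c = cong length (List.filter-none (λ x → x ℕ.≟ _) (All.replicate⁺ m d≢c))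

isSSYT? : Decidable (λ T → isSSYT T ≡ true)
isSSYT? T = isSSYT T Bool.≟ true

HasNonzeroEntry< : ℕ → List ℕ → Set
HasNonzeroEntry< N xs = Any (λ e → 0 < e × e < N) xs

IsRow : ℕ → ℕ → List ℕ → Set
IsRow l N x = length x ≡ l × All (_< N) x

content-TailDegree≥1 : ∀ n T → HasNonzeroEntry< (suc n) (concat T) → 1 ≤ tailDegree (content (suc n) T)
content-TailDegree≥1 n T nz with find nz
... | zero  , _   , (() , _)
... | suc e , e∈T , (_ , s≤s e<n) = begin
  1                                       ≤⟨ List.filter-some (λ x → x ℕ.≟ suc e) (Any.map sym e∈T) ⟩
  count (suc e) (concat T)                ≡⟨ cong (λ j → count (suc j) (concat T)) (Fin.toℕ-fromℕ< e<n) ⟨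
  counts i                                ≡⟨ Vec.lookup∘tabulate counts i ⟨
  Vec.lookup (Vec.tabulate counts) i      ≤⟨ lookup≤sum (Vec.tabulate counts) i ⟩
  tailDegree (content (suc n) T)          ∎
  where
  open ℕ.≤-Reasoning
  counts : Fin n → ℕ
  counts j = count (suc (toℕ j)) (concat T)
  i : Fin n
  i = fromℕ< e<n

listsOf-IsRow : ∀ l N → All (IsRow l N) (listsOf l N)
listsOf-IsRow zero    N = (refl , []) ∷ []
listsOf-IsRow (suc l) N = All-concatMap-∷ (upTo N) (listsOf l N)
  (All.map (λ i<N → All.map (λ (len , bounded) → cong suc len , i<N ∷ bounded) (listsOf-IsRow l N))
           (All.all-upTo N))

listsOf-zeros-first : ∀ l n → Σ (List (List ℕ)) λ R →
  listsOf l (suc n) ≡ replicate l 0 ∷ R × All (HasNonzeroEntry< (suc n)) R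
listsOf-zeros-first zero    n = [] , refl , []
listsOf-zeros-first (suc l) n with listsOf-zeros-first l n
... | R , listsOf≡ , R≠0 =
  map (0 ∷_) R ++ rest ,
  cong (λ L → map (0 ∷_) L ++ rest) listsOf≡ ,
  All.++⁺ (All.map⁺ (All.map there R≠0))
          (All-concatMap-∷ (applyUpTo suc n) (listsOf l (suc n))
            (All.applyUpTo⁺₁ suc n (λ i<n → All.universal (λ _ → here (s≤s z≤n , s≤s i<n)) _)))
  where
  rest : List (List ℕ)
  rest = concatMap (λ x → map (x ∷_) (listsOf l (suc n))) (applyUpTo suc n)

rowWeak-zeros : ∀ l → rowWeak (replicate l 0) ≡ true
rowWeak-zeros zero          = refl
rowWeak-zeros (suc zero)    = refl
rowWeak-zeros (suc (suc l)) = rowWeak-zeros (suc l)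

ssyt-HasNonzeroEntry< : ∀ {l₁ l₂ N} x y c → IsRow (suc l₁) N x → IsRow (suc l₂) N y →
  isSSYT (x ∷ y ∷ c) ≡ true → HasNonzeroEntry< N (concat (x ∷ y ∷ c))
ssyt-HasNonzeroEntry< []        _         _ (() , _) _              _
ssyt-HasNonzeroEntry< (_ ∷ _)   []        _ _        (() , _)       _
ssyt-HasNonzeroEntry< (x₀ ∷ xs) (y₀ ∷ ys) c _        (_ , y₀<N ∷ _) ssyt =
  Any.++⁺ʳ (x₀ ∷ xs) (here (ℕ.≤-<-trans z≤n x₀<y₀ , y₀<N))
  where
  x₀<y₀ : x₀ < y₀
  x₀<y₀ = ℕ.<ᵇ⇒< x₀ y₀ (Equivalence.from T-≡
    (∧-conicalˡ (x₀ <ᵇ y₀) _ (∧-conicalˡ (and (zipWith _<ᵇ_ (x₀ ∷ xs) (y₀ ∷ ys))) _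
      (∧-conicalʳ (and (map rowWeak ((x₀ ∷ xs) ∷ (y₀ ∷ ys) ∷ c))) _ ssyt))))

schur-one-row : ∀ m n → HeadedBy m (schur (m ∷ []) (suc n))
schur-one-row m n with listsOf-zeros-first m n
... | R , listsOf≡ , R≠0 = map (content N) (filter isSSYT? (rows R)) , schur≡ , tail≥1
  where
  N : ℕ
  N = suc n
  rows : List (List ℕ) → List (List (List ℕ))
  rows = concatMap (λ x → map (x ∷_) ([] ∷ []))
  zeros-ssyt : isSSYT (replicate m 0 ∷ []) ≡ true
  zeros-ssyt rewrite rowWeak-zeros m = refl
  content-zeros : content N (replicate m 0 ∷ []) ≡ x₀^ m
  content-zeros rewrite List.++-identityʳ (replicate m 0) =
    cong₂ Vec._∷_ (count-replicate-≡ m 0) (tabulate-zeros _ (λ i → count-replicate-≢ m (λ ())))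
  schur≡ : schur (m ∷ []) N ≡ x₀^ m ∷ map (content N) (filter isSSYT? (rows R))
  schur≡ = begin
    map (content N) (filter isSSYT? (rows (listsOf m N)))
      ≡⟨ cong (map (content N) ∘ filter isSSYT? ∘ rows) listsOf≡ ⟩
    map (content N) (filter isSSYT? ((replicate m 0 ∷ []) ∷ rows R))
      ≡⟨ cong (map (content N)) (List.filter-accept isSSYT? {x = replicate m 0 ∷ []} {xs = rows R} zeros-ssyt) ⟩
    content N (replicate m 0 ∷ []) ∷ map (content N) (filter isSSYT? (rows R))
      ≡⟨ cong (_∷ map (content N) (filter isSSYT? (rows R))) content-zeros ⟩
    x₀^ m ∷ map (content N) (filter isSSYT? (rows R)) ∎
    where open ≡-Reasoning
  tail≥1 : TailDegree≥ 1 (map (content N) (filter isSSYT? (rows R)))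
  tail≥1 = All.map⁺ (All-filter⇒ isSSYT? (rows R) (All-concatMap-∷ R ([] ∷ [])
             (All.map (λ {x} x≠0 → (λ _ → content-TailDegree≥1 n (x ∷ []) (Any.++⁺ˡ x≠0)) ∷ []) R≠0)))

schur-HeadedBy : ∀ {n} μ → ℓ μ ≤ 1 → HeadedBy ∣ μ ∣ₚ (schur μ (suc n))
schur-HeadedBy []          _ = [] , cong (λ v → (0 Vec.∷ v) ∷ []) (tabulate-zeros _ (λ _ → refl)) , []
schur-HeadedBy {n} (m ∷ []) _ =
  subst (λ d → HeadedBy d (schur (m ∷ []) (suc n))) (sym (ℕ.+-identityʳ m)) (schur-one-row m n)
schur-HeadedBy (_ ∷ _ ∷ _) (s≤s ())

schur-TailDegree≥1 : ∀ {n} μ → IsPartition μ → 1 < ℓ μ → TailDegree≥ 1 (schur μ (suc n))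
schur-TailDegree≥1 {n} (suc l₁ ∷ suc l₂ ∷ μ) _ _ =
  All.map⁺ (All-filter⇒ isSSYT? (fillings (suc l₁ ∷ suc l₂ ∷ μ) N)
    (All-concatMap-∷ (listsOf (suc l₁) N) _ (All.map (λ {x} x-row →
      All-concatMap-∷ (listsOf (suc l₂) N) _ (All.map (λ {y} y-row →
        All.universal (λ c ssyt →
          content-TailDegree≥1 n (x ∷ y ∷ c) (ssyt-HasNonzeroEntry< x y c x-row y-row ssyt)) _)
      (listsOf-IsRow (suc l₂) N)))
    (listsOf-IsRow (suc l₁) N))))
  where
  N : ℕ
  N = suc n
schur-TailDegree≥1 []                   _                   ()
schur-TailDegree≥1 (_ ∷ [])             _                   (s≤s ())
schur-TailDegree≥1 (zero ∷ _ ∷ _)       (() ∷ _ , _)        _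
schur-TailDegree≥1 (suc _ ∷ zero ∷ _)   (_ ∷ () ∷ _ , _)    _

module _ (μ : List ℕ) (a z : ℤ) (as zs : List ℤ) where

  bSeq : ℕ → ℕ
  bSeq n = b ((a ∷ as) ⊕₁ (+ n)) μ ((z ∷ zs) ⊕₁ (+ (∣ μ ∣ₚ * n)))

  private
    d n₁ a₀ : ℕ
    d  = ∣ μ ∣ₚ
    n₁ = proj₁ (ℤ-shift-nonneg a)
    a₀ = proj₁ (proj₂ (ℤ-shift-nonneg a))
    g P : Poly (suc (length zs))
    g = schur μ (suc (length zs))
    P = hλPleth as g

    coeffAt : ℕ → ℤ → ℕ
    coeffAt r w = coeff (hPleth (+ r) g *ₚ P) (w ∷ zs)

    -- Unfolding b, bSeq n is already coeff (hPleth (a + n) g *ₚ P) ((z + d n) ∷ zs).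
    bSeq-shifted : ∀ t → bSeq (n₁ + t) ≡ coeffAt (a₀ + t) (z ℤ.+ + (d * (n₁ + t)))
    bSeq-shifted t = cong (λ r → coeff (hPleth r g *ₚ P) ((z ℤ.+ + (d * (n₁ + t))) ∷ zs))
                          (proj₂ (proj₂ (ℤ-shift-nonneg a)) t)

    head-step : ∀ t → z ℤ.+ + (d * suc t) ≡ (z ℤ.+ + (d * t)) ℤ.+ + d
    head-step t = begin
      z ℤ.+ + (d * suc t)          ≡⟨ cong (λ k → z ℤ.+ + k) (trans (ℕ.*-suc d t) (ℕ.+-comm d (d * t))) ⟩
      z ℤ.+ + (d * t + d)          ≡⟨ cong (λ k → z ℤ.+ k) (ℤ.pos-+ (d * t) d) ⟩
      z ℤ.+ (+ (d * t) ℤ.+ + d)    ≡⟨ ℤ.+-assoc z (+ (d * t)) (+ d) ⟨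
      (z ℤ.+ + (d * t)) ℤ.+ + d    ∎
      where open ≡-Reasoning

  bSeq-eventually-0 : TailDegree≥ 1 g → Eventually (λ n → bSeq n ≡ 0)
  bSeq-eventually-0 g≥1 = eventually-+ n₁ (suc (absSum zs) , λ t zs<t →
    trans (bSeq-shifted t)
          (coeff-hPleth-*ₚ-vanish (a₀ + t) g P _ zs g≥1 (ℕ.≤-trans zs<t (ℕ.m≤n+m t a₀))))

  bSeq-eventually-const : HeadedBy d g → Σ ℕ λ c → Eventually (λ n → bSeq n ≡ c)
  bSeq-eventually-const headed =
    let c , ev = eventually-stable⇒const (λ t → bSeq (n₁ + t)) (absSum zs , stable) in c , eventually-+ n₁ ev
    where
    stable : ∀ t → absSum zs ≤ t → bSeq (n₁ + suc t) ≡ bSeq (n₁ + t)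
    stable t zs≤t = begin
      bSeq (n₁ + suc t)                                     ≡⟨ bSeq-shifted (suc t) ⟩
      coeffAt (a₀ + suc t) (z ℤ.+ + (d * (n₁ + suc t)))
        ≡⟨ cong₂ coeffAt (ℕ.+-suc a₀ t)
                 (trans (cong (λ k → z ℤ.+ + (d * k)) (ℕ.+-suc n₁ t)) (head-step (n₁ + t))) ⟩
      coeffAt (suc (a₀ + t)) ((z ℤ.+ + (d * (n₁ + t))) ℤ.+ + d)
        ≡⟨ coeff-hPleth-*ₚ-stable d (a₀ + t) g P _ zs headed (ℕ.≤-trans zs≤t (ℕ.m≤n+m t a₀)) ⟩
      coeffAt (a₀ + t) (z ℤ.+ + (d * (n₁ + t)))             ≡⟨ bSeq-shifted t ⟨
      bSeq (n₁ + t)                                         ∎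
      where open ≡-Reasoning

  bSeq-eventually : IsPartition μ →
    (Σ ℕ λ c → Eventually (λ n → bSeq n ≡ c)) × (1 < ℓ μ → Eventually (λ n → bSeq n ≡ 0))
  bSeq-eventually μ-partition with 1 <? ℓ μ
  ... | yes 1<ℓ = let ev = bSeq-eventually-0 (schur-TailDegree≥1 μ μ-partition 1<ℓ) in (0 , ev) , λ _ → ev
  ... | no 1≮ℓ  = bSeq-eventually-const (schur-HeadedBy μ (ℕ.≮⇒≥ 1≮ℓ)) , λ 1<ℓ → ⊥-elim (1≮ℓ 1<ℓ)

theorem3p2 : (μ : List ℕ) → IsPartition μ → (la nu : List ℤ) →
    (Σ ℕ λ c → Σ ℕ λ n₀ → (n : ℕ) → n₀ ≤ n →
        b (la ⊕₁ (+ n)) μ (nu ⊕₁ (+ (∣ μ ∣ₚ * n))) ≡ c)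
    × (1 < ℓ μ → Σ ℕ λ n₀ → (n : ℕ) → n₀ ≤ n →
        b (la ⊕₁ (+ n)) μ (nu ⊕₁ (+ (∣ μ ∣ₚ * n))) ≡ 0)
-- [] ⊕₁ (+ k) and (+ 0 ∷ []) ⊕₁ (+ k) are definitionally equal.
theorem3p2 μ μ-partition []       []       = bSeq-eventually μ (+ 0) (+ 0) [] [] μ-partition
theorem3p2 μ μ-partition []       (z ∷ zs) = bSeq-eventually μ (+ 0) z    [] zs μ-partition
theorem3p2 μ μ-partition (a ∷ as) []       = bSeq-eventually μ a     (+ 0) as [] μ-partition
theorem3p2 μ μ-partition (a ∷ as) (z ∷ zs) = bSeq-eventually μ a     z    as zs μ-partition
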